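{- Let $T$ be a finite tree with $m$ interior edges, and let $\mathcal{S}$ be the collection of all subtrees of $T$ (identified with their edge sets) having exactly one interior edge. Then $$\sum_{S\in\mathcal{S}}(-1)^{|S|}=-m,$$ where $|S|$ is the number of edges of $S$.
   Context: A subtree of $T$ is a connected subgraph of $T$, identified with its (nonempty) edge set. An edge of a tree (or subtree) $S$ is a leaf edge of $S$ if at least one of its endpoints has degree $1$ in $S$; an edge of $S$ is interior in $S$ if it is not a leaf edge of $S$, i.e., both its endpoints have degree at least $2$ in $S$. The interior edges of $T$ are the edges interior in $T$ itself. -}

module Defs where

open import Data.Nat using (ℕ; zero; suc; _≤ᵇ_; _≡ᵇ_)
open import Data.Bool using (Bool; true; false; _∧_; _∨_)
open import Data.Fin using (Fin)
open import Data.Fin.Subset using (Subset; _∈_; ⊤)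
open import Data.Fin.Properties using (_≟_)
open import Data.Product using (_×_; proj₁; proj₂; ∃; _,_)
import Data.List
open import Data.List using (List; length; filterᵇ; allFin)
open import Data.Vec using (lookup)
open import Relation.Nullary using (does)
open import Relation.Binary.PropositionalEquality using (_≡_)

-- A finite (multi)graph with vertex set Fin n and edge set Fin e;
-- edge i has endpoints  ends i = (u , v).  An edge set is a Subset e.
Ends : ℕ → ℕ → Set
Ends n e = Fin e → Fin n × Fin n

module _ {n e : ℕ} (ends : Ends n e) where

  data Reach (S : Subset e) : Fin n → Fin n → Set where
    here : ∀ {u} → Reach S u u
    fwd  : ∀ {w} (i : Fin e) → i ∈ S → Reach S (proj₂ (ends i)) w → Reach S (proj₁ (ends i)) w
    bwd  : ∀ {w} (i : Fin e) → i ∈ S → Reach S (proj₁ (ends i)) w → Reach S (proj₂ (ends i)) w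

  -- The whole graph is a tree: connected, with |V| = |E| + 1
  -- (a connected finite graph with |V| = |E| + 1 is exactly a tree).
  IsTree : Set
  IsTree = (n ≡ suc e) × (∀ u v → Reach ⊤ u v)

  -- S is a subtree: a nonempty edge set whose subgraph (edges of S with
  -- their endpoints) is connected.  (Acyclicity is inherited from T.)
  IsSubtree : Subset e → Set
  IsSubtree S = (∃ λ i → i ∈ S) ×
                (∀ i j → i ∈ S → j ∈ S → Reach S (proj₁ (ends i)) (proj₁ (ends j)))

  incident : Fin e → Fin n → Bool
  incident i v = does (proj₁ (ends i) ≟ v) ∨ does (proj₂ (ends i) ≟ v)

  degIn : Subset e → Fin n → ℕ
  degIn S v = length (filterᵇ (λ i → lookup S i ∧ incident i v) (allFin e))

  isInterior : Subset e → Fin e → Bool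
  isInterior S i = lookup S i ∧ ((2 ≤ᵇ degIn S (proj₁ (ends i))) ∧ (2 ≤ᵇ degIn S (proj₂ (ends i))))

  numInterior : Subset e → ℕ
  numInterior S = length (filterᵇ (isInterior S) (allFin e))

open import Data.Integer as ℤ using (ℤ)
sumℤ : List ℤ → ℤ
sumℤ = Data.List.foldr ℤ._+_ (ℤ.+ 0)

-- A subtree S has exactly one interior edge f iff it is a double star around
-- f: f is interior in S and every edge of S shares an endpoint with f.  (If
-- another edge g of S were interior, the further edges of S at both ends of g
-- would all touch f, closing a cycle through g; conversely, walking in S away
-- from f, a vertex off f can only be a leaf, since its edge towards f would
-- otherwise be a second interior edge.)  So the sum splits over f.  If f has a
-- further edges at one end and b at the other (disjoint, as a tree has no
-- parallel edges), the double stars around f are f with nonempty sets A, B of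
-- these, contributing -(Σ_{A≠∅} (-1)^|A|)(Σ_{B≠∅} (-1)^|B|): this is -1 when
-- a, b ≥ 1, i.e. when f is interior in T, and 0 otherwise.

module Submission where

open import Defs
open import Data.Bool using (Bool; true; false; _∧_; _∨_; not; if_then_else_)
open import Data.Bool.Properties using (∧-identityʳ; ∧-conicalˡ; ∧-conicalʳ; ∨-zeroʳ; ¬-not; T-≡) renaming (_≟_ to _≟ᵇ_)
open import Data.Empty using (⊥; ⊥-elim)
open import Data.Fin using (Fin; zero; suc)
open import Data.Fin.Properties using (_≟_; suc-injective)
open import Data.Fin.Subset using (Subset; ∣_∣; ⊤) renaming (_∈_ to _∈ₛ_)
open import Data.Fin.Subset.Properties using (∈⊤)
open import Data.Integer using (ℤ; +_; -_; _+_; _*_; _-_; _^_; -1ℤ; 0ℤ; 1ℤ)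
open import Data.Integer.Properties using (+-identityˡ; +-identityʳ; +-assoc; +-0-commutativeMonoid)
open import Data.Integer.Tactic.RingSolver using (solve-∀)
open import Data.List using (List; []; _∷_; map; length; filterᵇ)
import Data.List as List
open import Data.List.Membership.Propositional using (_∈_)
open import Data.List.Relation.Unary.Any using (here; there)
import Data.List.Relation.Unary.All as All
open import Data.List.Relation.Unary.AllPairs using ([]; _∷_)
open import Data.List.Relation.Unary.Unique.Propositional using (Unique)
open import Data.Nat as ℕ using (ℕ; zero; suc; _≤_; z≤n; s≤s; _≤ᵇ_)
open import Data.Nat.Properties as ℕ using (≤-reflexive; ≤-trans; n≤1+n; +-suc; +-monoˡ-≤; 1+n≰n; ≤⇒≤ᵇ; ≤ᵇ⇒≤; module ≤-Reasoning)
open import Data.Product using (Σ; ∃; _×_; _,_; proj₁; proj₂)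
open import Data.Sum using (_⊎_; inj₁; inj₂)
open import Data.Vec using ([]; _∷_; lookup; tabulate)
open import Data.Vec.Properties using (lookup∘tabulate; lookup-replicate; []=⇒lookup; lookup⇒[]=)
open import Function using (_∘_; case_of_)
open import Function.Bundles using (_⇔_; mk⇔; Equivalence)
import Function.Properties.Equivalence as ⇔
open import Relation.Nullary using (¬_; Dec; does; yes; no)
open import Relation.Nullary.Decidable using (dec-true; dec-false)
open import Relation.Binary.PropositionalEquality using (_≡_; _≢_; refl; sym; trans; cong; cong₂; subst; module ≡-Reasoning)
open import Algebra.Properties.CommutativeMonoid.Sum +-0-commutativeMonoid using (sum-syntax; sum-cong-≗)

does⇒ : ∀ {P : Set} (d : Dec P) → does d ≡ true → P
does⇒ (yes p) _ = p

count : (k : ℕ) → (Fin k → Bool) → ℕ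
count zero    p = 0
count (suc k) p = (if p zero then 1 else 0) ℕ.+ count k (p ∘ suc)

length-filter-tabulate : ∀ {A : Set} k (f : Fin k → A) (p : A → Bool) →
  length (filterᵇ p (List.tabulate f)) ≡ count k (p ∘ f)
length-filter-tabulate zero    f p = refl
length-filter-tabulate (suc k) f p with p (f zero)
... | true  = cong suc (length-filter-tabulate k (f ∘ suc) p)
... | false = length-filter-tabulate k (f ∘ suc) p

count-cong : ∀ k {p q : Fin k → Bool} → (∀ i → p i ≡ q i) → count k p ≡ count k q
count-cong zero    p≗q = refl
count-cong (suc k) p≗q rewrite p≗q zero = cong (_ ℕ.+_) (count-cong k (p≗q ∘ suc))

count-mono : ∀ k {p q : Fin k → Bool} → (∀ i → p i ≡ true → q i ≡ true) → count k p ≤ count k q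
count-mono zero    p⊆q = z≤n
count-mono (suc k) {p} {q} p⊆q with p zero in p₀ | q zero in q₀
... | true  | true  = s≤s (count-mono k (p⊆q ∘ suc))
... | true  | false with () ← trans (sym (p⊆q zero p₀)) q₀
... | false | true  = ≤-trans (count-mono k (p⊆q ∘ suc)) (n≤1+n _)
... | false | false = count-mono k (p⊆q ∘ suc)

count-all : ∀ k {p : Fin k → Bool} → (∀ i → p i ≡ true) → count k p ≡ k
count-all zero    all = refl
count-all (suc k) all rewrite all zero = cong suc (count-all k (all ∘ suc))

count-none : ∀ k {p : Fin k → Bool} → (∀ i → p i ≡ false) → count k p ≡ 0
count-none zero    none = refl
count-none (suc k) none rewrite none zero = count-none k (none ∘ suc)

count>0⇒witness : ∀ k {p : Fin k → Bool} → 1 ≤ count k p → ∃ λ i → p i ≡ true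
count>0⇒witness (suc k) {p} 1≤c with p zero in p₀
... | true  = zero , p₀
... | false with i , pᵢ ← count>0⇒witness k 1≤c = suc i , pᵢ

count-pos : ∀ k {p : Fin k → Bool} {i} → p i ≡ true → 1 ≤ count k p
count-pos (suc k) {p} {zero}  pᵢ rewrite pᵢ = s≤s z≤n
count-pos (suc k) {p} {suc i} pᵢ with p zero
... | true  = s≤s z≤n
... | false = count-pos k pᵢ

erase : ∀ {k} → (Fin k → Bool) → Fin k → Fin k → Bool
erase p i j = p j ∧ not (does (j ≟ i))

count-erase : ∀ k {p : Fin k → Bool} i → p i ≡ true → count k p ≡ suc (count k (erase p i))
count-erase (suc k) {p} zero    pᵢ rewrite pᵢ = cong suc (count-cong k (λ j → sym (∧-identityʳ (p (suc j)))))
count-erase (suc k) {p} (suc i) pᵢ with p zero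
... | true  = cong suc (count-erase k i pᵢ)
... | false = count-erase k i pᵢ

count≤suc-erase : ∀ k {p : Fin k → Bool} i → count k p ≤ suc (count k (erase p i))
count≤suc-erase k {p} i with p i in pᵢ
... | true  = ≤-reflexive (count-erase k i pᵢ)
... | false = ≤-trans (≤-reflexive (count-cong k p≗erase)) (n≤1+n _)
  where
  p≗erase : ∀ j → p j ≡ erase p i j
  p≗erase j with j ≟ i
  ... | yes refl rewrite pᵢ = refl
  ... | no _     = sym (∧-identityʳ (p j))

erase-true : ∀ {k} {p : Fin k → Bool} {i j} → p j ≡ true → j ≢ i → erase p i j ≡ true
erase-true {i = i} {j} pⱼ j≢i rewrite pⱼ | dec-false (j ≟ i) j≢i = refl

erase-true⁻¹ : ∀ {k} {p : Fin k → Bool} {i j} → erase p i j ≡ true → j ≢ i × p j ≡ true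
erase-true⁻¹ {p = p} {i} {j} e = j≢i , ∧-conicalˡ _ _ e
  where
  j≢i : j ≢ i
  j≢i j≡i = case trans (sym (∧-conicalʳ _ _ e)) (cong not (dec-true (j ≟ i) j≡i)) of λ ()

count≥2 : ∀ k {p : Fin k → Bool} {i j} → p i ≡ true → p j ≡ true → j ≢ i → 2 ≤ count k p
count≥2 k {p} {i} pᵢ pⱼ j≢i rewrite count-erase k {p} i pᵢ =
  s≤s (count-pos k {erase p i} (erase-true {p = p} pⱼ j≢i))

count≥2⇒other : ∀ k {p : Fin k → Bool} {i} → 2 ≤ count k p → p i ≡ true → ∃ λ j → j ≢ i × p j ≡ true
count≥2⇒other k {p} {i} 2≤c pᵢ rewrite count-erase k {p} i pᵢ with s≤s 1≤c ← 2≤c =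
  let j , e = count>0⇒witness k 1≤c in j , erase-true⁻¹ {p = p} e

count≡1-intro : ∀ k {p : Fin k → Bool} {i} → p i ≡ true → (∀ j → p j ≡ true → j ≡ i) → count k p ≡ 1
count≡1-intro k {p} {i} pᵢ unique = trans (count-erase k i pᵢ) (cong suc (count-none k only-i))
  where
  only-i : ∀ j → erase p i j ≡ false
  only-i j = ¬-not λ e → let j≢i , pⱼ = erase-true⁻¹ {p = p} {i} e in j≢i (unique j pⱼ)

count≡1-elim : ∀ k {p : Fin k → Bool} → count k p ≡ 1 → ∃ λ i → p i ≡ true × (∀ j → p j ≡ true → j ≡ i)
count≡1-elim k {p} c≡1 with i , pᵢ ← count>0⇒witness k (≤-reflexive (sym c≡1)) = i , pᵢ , unique
  where
  unique : ∀ j → p j ≡ true → j ≡ i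
  unique j pⱼ with j ≟ i
  ... | yes j≡i = j≡i
  ... | no j≢i  with s≤s () ← subst (2 ≤_) c≡1 (count≥2 k pᵢ pⱼ j≢i)

any : (k : ℕ) → (Fin k → Bool) → Bool
any zero    p = false
any (suc k) p = p zero ∨ any k (p ∘ suc)

any-intro : ∀ k {p : Fin k → Bool} i → p i ≡ true → any k p ≡ true
any-intro (suc k) zero    pᵢ rewrite pᵢ = refl
any-intro (suc k) {p} (suc i) pᵢ with p zero
... | true  = refl
... | false = any-intro k i pᵢ

any-elim : ∀ k {p : Fin k → Bool} → any k p ≡ true → ∃ λ i → p i ≡ true
any-elim (suc k) {p} h with p zero in p₀
... | true  = zero , p₀
... | false with i , pᵢ ← any-elim k h = suc i , pᵢ

data Role : Set where
  centre arm₁ arm₂ other : Role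

admits : Role → Bool → Bool
admits centre s = s
admits other  true  = false
admits other  false = true
admits arm₁   _ = true
admits arm₂   _ = true

isArm₁ isArm₂ isCentre : Role → Bool
isArm₁ arm₁ = true
isArm₁ _    = false
isArm₂ arm₂ = true
isArm₂ _    = false
isCentre centre = true
isCentre _      = false

-- shape k r x y S: S contains every centre, no other, and meets arm₁
-- (unless x) and arm₂ (unless y); the flags record arms already met.
shape : (k : ℕ) → (Fin k → Role) → Bool → Bool → Subset k → Bool
shape zero    r x y []      = x ∧ y
shape (suc k) r x y (s ∷ S) =
  admits (r zero) s ∧ shape k (r ∘ suc) (isArm₁ (r zero) ∧ s ∨ x) (isArm₂ (r zero) ∧ s ∨ y) S

Met : ∀ {k} → Bool → (Fin k → Bool) → Subset k → Set
Met x a S = x ≡ true ⊎ ∃ λ i → a i ≡ true × lookup S i ≡ true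

record Fits {k} (r : Fin k → Role) (x y : Bool) (S : Subset k) : Set where
  field
    centreIn : ∀ i → r i ≡ centre → lookup S i ≡ true
    otherOut : ∀ i → r i ≡ other → lookup S i ≡ false
    met₁     : Met x (isArm₁ ∘ r) S
    met₂     : Met y (isArm₂ ∘ r) S

Met-cons : ∀ {k} {a : Fin (suc k) → Bool} {x s} {S : Subset k} →
           Met (a zero ∧ s ∨ x) (a ∘ suc) S → Met x a (s ∷ S)
Met-cons (inj₂ (i , aᵢ , Sᵢ)) = inj₂ (suc i , aᵢ , Sᵢ)
Met-cons {a = a} {x} {s} (inj₁ h) with a zero in a₀ | s
... | true  | true  = inj₂ (zero , a₀ , refl)
... | true  | false = inj₁ h
... | false | _     = inj₁ h

Met-uncons : ∀ {k} {a : Fin (suc k) → Bool} {x s} {S : Subset k} →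
             Met x a (s ∷ S) → Met (a zero ∧ s ∨ x) (a ∘ suc) S
Met-uncons {a = a} (inj₁ refl) = inj₁ (∨-zeroʳ _)
Met-uncons (inj₂ (zero , a₀ , refl)) rewrite a₀ = inj₁ refl
Met-uncons (inj₂ (suc i , aᵢ , Sᵢ)) = inj₂ (i , aᵢ , Sᵢ)

admits-centre : ∀ {ρ s} → admits ρ s ≡ true → ρ ≡ centre → s ≡ true
admits-centre h refl = h

admits-other : ∀ {ρ s} → admits ρ s ≡ true → ρ ≡ other → s ≡ false
admits-other {s = false} h refl = refl

admits-intro : ∀ ρ s → (ρ ≡ centre → s ≡ true) → (ρ ≡ other → s ≡ false) → admits ρ s ≡ true
admits-intro centre s c _     = c refl
admits-intro other  true _ o with () ← o refl
admits-intro other  false _ _ = refl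
admits-intro arm₁   s _ _     = refl
admits-intro arm₂   s _ _     = refl

shape⇒Fits : ∀ k (r : Fin k → Role) x y S → shape k r x y S ≡ true → Fits r x y S
shape⇒Fits zero r true true [] refl =
  record { centreIn = λ () ; otherOut = λ () ; met₁ = inj₁ refl ; met₂ = inj₁ refl }
shape⇒Fits (suc k) r x y (s ∷ S) h = record
  { centreIn = λ { zero p → admits-centre adm p ; (suc i) p → Fits.centreIn tail i p }
  ; otherOut = λ { zero p → admits-other adm p ; (suc i) p → Fits.otherOut tail i p }
  ; met₁ = Met-cons (Fits.met₁ tail)
  ; met₂ = Met-cons (Fits.met₂ tail) }
  where
  adm  = ∧-conicalˡ _ _ h
  tail = shape⇒Fits k (r ∘ suc) _ _ S (∧-conicalʳ (admits (r zero) s) _ h)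

Fits⇒shape : ∀ k (r : Fin k → Role) x y S → Fits r x y S → shape k r x y S ≡ true
Fits⇒shape zero r x y [] fits with Fits.met₁ fits | Fits.met₂ fits
... | inj₁ refl | inj₁ refl = refl
Fits⇒shape (suc k) r x y (s ∷ S) fits
  rewrite admits-intro (r zero) s (Fits.centreIn fits zero) (Fits.otherOut fits zero) =
  Fits⇒shape k (r ∘ suc) _ _ S record
    { centreIn = Fits.centreIn fits ∘ suc
    ; otherOut = Fits.otherOut fits ∘ suc
    ; met₁ = Met-uncons (Fits.met₁ fits)
    ; met₂ = Met-uncons (Fits.met₂ fits) }

isArm₁-true : ∀ {ρ} → isArm₁ ρ ≡ true → ρ ≡ arm₁
isArm₁-true {arm₁} _ = refl

isArm₂-true : ∀ {ρ} → isArm₂ ρ ≡ true → ρ ≡ arm₂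
isArm₂-true {arm₂} _ = refl

isCentre-true : ∀ {ρ} → isCentre ρ ≡ true → ρ ≡ centre
isCentre-true {centre} _ = refl

Met-false⇒any : ∀ {k} {a : Fin k → Bool} {S} → Met false a S → any k a ≡ true
Met-false⇒any {k} (inj₂ (i , aᵢ , _)) = any-intro k i aᵢ

any⇒Met-⊤ : ∀ {k} {a : Fin k → Bool} → any k a ≡ true → Met false a ⊤
any⇒Met-⊤ {k} h with i , aᵢ ← any-elim k h = inj₂ (i , aᵢ , lookup-replicate i true)

∑ˢ : (k : ℕ) → (Subset k → ℤ) → ℤ
∑ˢ zero    h = h []
∑ˢ (suc k) h = ∑ˢ k (h ∘ (true ∷_)) + ∑ˢ k (h ∘ (false ∷_))

∑ˢ-cong : ∀ k {g h : Subset k → ℤ} → (∀ S → g S ≡ h S) → ∑ˢ k g ≡ ∑ˢ k h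
∑ˢ-cong zero    g≗h = g≗h []
∑ˢ-cong (suc k) g≗h = cong₂ _+_ (∑ˢ-cong k (g≗h ∘ (true ∷_))) (∑ˢ-cong k (g≗h ∘ (false ∷_)))

∑ˢ-zero : ∀ k → ∑ˢ k (λ _ → 0ℤ) ≡ 0ℤ
∑ˢ-zero zero    = refl
∑ˢ-zero (suc k) rewrite ∑ˢ-zero k = refl

∑ˢ-*ˡ : ∀ k a (h : Subset k → ℤ) → ∑ˢ k (λ S → a * h S) ≡ a * ∑ˢ k h
∑ˢ-*ˡ zero    a h = refl
∑ˢ-*ˡ (suc k) a h rewrite ∑ˢ-*ˡ k a (h ∘ (true ∷_)) | ∑ˢ-*ˡ k a (h ∘ (false ∷_)) =
  distribˡ a (∑ˢ k (h ∘ (true ∷_))) (∑ˢ k (h ∘ (false ∷_)))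
  where
  distribˡ : ∀ a b c → a * b + a * c ≡ a * (b + c)
  distribˡ = solve-∀

∑ˢ-distrib-+ : ∀ k (g h : Subset k → ℤ) → ∑ˢ k (λ S → g S + h S) ≡ ∑ˢ k g + ∑ˢ k h
∑ˢ-distrib-+ zero    g h = refl
∑ˢ-distrib-+ (suc k) g h
  rewrite ∑ˢ-distrib-+ k (g ∘ (true ∷_)) (h ∘ (true ∷_)) | ∑ˢ-distrib-+ k (g ∘ (false ∷_)) (h ∘ (false ∷_)) =
  middle-swap (∑ˢ k (g ∘ (true ∷_))) (∑ˢ k (h ∘ (true ∷_))) (∑ˢ k (g ∘ (false ∷_))) (∑ˢ k (h ∘ (false ∷_)))
  where
  middle-swap : ∀ a b c d → (a + b) + (c + d) ≡ (a + c) + (b + d)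
  middle-swap = solve-∀

∑ˢ-∑-comm : ∀ k m (h : Subset k → Fin m → ℤ) → ∑ˢ k (λ S → ∑[ i < m ] h S i) ≡ ∑[ i < m ] ∑ˢ k (λ S → h S i)
∑ˢ-∑-comm k zero    h = ∑ˢ-zero k
∑ˢ-∑-comm k (suc m) h =
  trans (∑ˢ-distrib-+ k (λ S → h S zero) _)
        (cong (λ t → ∑ˢ k (λ S → h S zero) + t) (∑ˢ-∑-comm k m (λ S → h S ∘ suc)))

∑-indicator-unique : ∀ m (p : Fin m → Bool) z → (∀ {i j} → p i ≡ true → p j ≡ true → i ≡ j) →
  ∑[ i < m ] (if p i then z else 0ℤ) ≡ (if any m p then z else 0ℤ)
∑-indicator-unique zero    p z unique = refl
∑-indicator-unique (suc m) p z unique with p zero in p₀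
... | true  = trans (cong (λ t → z + t) rest) (+-identityʳ z)
  where
  rest : ∑[ i < m ] (if p (suc i) then z else 0ℤ) ≡ 0ℤ
  rest with any m (p ∘ suc) in any₀ | ∑-indicator-unique m (p ∘ suc) z (λ pᵢ pⱼ → suc-injective (unique pᵢ pⱼ))
  ... | false | eq = eq
  ... | true  | _ with i , pᵢ ← any-elim m any₀ with () ← unique p₀ pᵢ
... | false = trans (+-identityˡ _) (∑-indicator-unique m (p ∘ suc) z (λ pᵢ pⱼ → suc-injective (unique pᵢ pⱼ)))

∑-indicator-count : ∀ m (p : Fin m → Bool) → ∑[ i < m ] (if p i then -1ℤ else 0ℤ) ≡ - (+ count m p)
∑-indicator-count zero    p = refl
∑-indicator-count (suc m) p with p zero
... | false = trans (+-identityˡ _) (∑-indicator-count m (p ∘ suc))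
... | true rewrite ∑-indicator-count m (p ∘ suc) with count m (p ∘ suc)
...   | zero  = refl
...   | suc _ = refl

sgn : ∀ {k} → Subset k → ℤ
sgn S = -1ℤ ^ ∣ S ∣

⟦_⟧ : Bool → ℤ
⟦ b ⟧ = if b then 1ℤ else 0ℤ

signedShape : (k : ℕ) → (Fin k → Role) → Bool → Bool → ℤ
signedShape k r x y = ∑ˢ k (λ S → if shape k r x y S then sgn S else 0ℤ)

∑ˢ-negate : ∀ k (b : Subset k → Bool) →
  ∑ˢ k (λ S → if b S then -1ℤ * sgn S else 0ℤ) ≡ -1ℤ * ∑ˢ k (λ S → if b S then sgn S else 0ℤ)
∑ˢ-negate k b = trans (∑ˢ-cong k (λ S → if-*ˡ (b S) (sgn S))) (∑ˢ-*ˡ k -1ℤ _)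
  where
  if-*ˡ : ∀ b z → (if b then -1ℤ * z else 0ℤ) ≡ -1ℤ * (if b then z else 0ℤ)
  if-*ˡ true  z = refl
  if-*ˡ false z = refl

-- Each arm edge contributes a factor 1 - 1 = 0 unless its flag is already
-- set, which is why only whether an arm exists survives.
signedShape-closed : ∀ k r x y → signedShape k r x y ≡
  (-1ℤ ^ count k (isCentre ∘ r)) * ((⟦ x ⟧ - ⟦ any k (isArm₁ ∘ r) ⟧) * (⟦ y ⟧ - ⟦ any k (isArm₂ ∘ r) ⟧))
signedShape-closed zero r true  true  = refl
signedShape-closed zero r true  false = refl
signedShape-closed zero r false true  = refl
signedShape-closed zero r false false = refl
signedShape-closed (suc k) r x y with r zero
... | centre = trans (cong₂ _+_ (trans (∑ˢ-negate k _) (cong (-1ℤ *_) (ih x y))) (∑ˢ-zero k))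
                     (centre-ring P ⟦ x ⟧ A ⟦ y ⟧ B)
  where
  ih = signedShape-closed k (r ∘ suc)
  P = -1ℤ ^ count k (isCentre ∘ r ∘ suc)
  A = ⟦ any k (isArm₁ ∘ r ∘ suc) ⟧
  B = ⟦ any k (isArm₂ ∘ r ∘ suc) ⟧
  centre-ring : ∀ P X A Y B → -1ℤ * (P * ((X - A) * (Y - B))) + 0ℤ ≡ (-1ℤ * P) * ((X - A) * (Y - B))
  centre-ring = solve-∀
... | other = trans (cong₂ _+_ (∑ˢ-zero k) (signedShape-closed k (r ∘ suc) x y)) (+-identityˡ _)
... | arm₁ = trans (cong₂ _+_ (trans (∑ˢ-negate k _) (cong (-1ℤ *_) (ih true y))) (ih x y))
                   (arm₁-ring P ⟦ x ⟧ A ⟦ y ⟧ B)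
  where
  ih = signedShape-closed k (r ∘ suc)
  P = -1ℤ ^ count k (isCentre ∘ r ∘ suc)
  A = ⟦ any k (isArm₁ ∘ r ∘ suc) ⟧
  B = ⟦ any k (isArm₂ ∘ r ∘ suc) ⟧
  arm₁-ring : ∀ P X A Y B → -1ℤ * (P * ((1ℤ - A) * (Y - B))) + P * ((X - A) * (Y - B)) ≡ P * ((X - 1ℤ) * (Y - B))
  arm₁-ring = solve-∀
... | arm₂ = trans (cong₂ _+_ (trans (∑ˢ-negate k _) (cong (-1ℤ *_) (ih x true))) (ih x y))
                   (arm₂-ring P ⟦ x ⟧ A ⟦ y ⟧ B)
  where
  ih = signedShape-closed k (r ∘ suc)
  P = -1ℤ ^ count k (isCentre ∘ r ∘ suc)
  A = ⟦ any k (isArm₁ ∘ r ∘ suc) ⟧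
  B = ⟦ any k (isArm₂ ∘ r ∘ suc) ⟧
  arm₂-ring : ∀ P X A Y B → -1ℤ * (P * ((X - A) * (1ℤ - B))) + P * ((X - A) * (Y - B)) ≡ P * ((X - A) * (Y - 1ℤ))
  arm₂-ring = solve-∀

tailsWith : ∀ {k} → Bool → List (Subset (suc k)) → List (Subset k)
tailsWith b []            = []
tailsWith b ((s ∷ S) ∷ L) = if does (s ≟ᵇ b) then S ∷ tailsWith b L else tailsWith b L

sum-tailsWith : ∀ {k} (g : Subset (suc k) → ℤ) L → sumℤ (map g L) ≡
  sumℤ (map (g ∘ (true ∷_)) (tailsWith true L)) + sumℤ (map (g ∘ (false ∷_)) (tailsWith false L))
sum-tailsWith g [] = refl
sum-tailsWith g ((true ∷ S) ∷ L) rewrite sum-tailsWith g L = sym (+-assoc (g (true ∷ S)) _ _)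
sum-tailsWith g ((false ∷ S) ∷ L) rewrite sum-tailsWith g L =
  swap (g (false ∷ S)) (sumℤ (map (g ∘ (true ∷_)) (tailsWith true L)))
       (sumℤ (map (g ∘ (false ∷_)) (tailsWith false L)))
  where
  swap : ∀ a b c → a + (b + c) ≡ b + (a + c)
  swap = solve-∀

∈-tailsWith⁻ : ∀ {k b} {S : Subset k} L → S ∈ tailsWith b L → (b ∷ S) ∈ L
∈-tailsWith⁻ {b = b} ((s ∷ S′) ∷ L) m with s ≟ᵇ b | m
... | yes refl | here refl = here refl
... | yes refl | there m′ = there (∈-tailsWith⁻ L m′)
... | no _     | m′       = there (∈-tailsWith⁻ L m′)

∈-tailsWith⁺ : ∀ {k b} {S : Subset k} L → (b ∷ S) ∈ L → S ∈ tailsWith b L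
∈-tailsWith⁺ {b = b} ((s ∷ S′) ∷ L) m with s ≟ᵇ b | m
... | yes refl | here refl = here refl
... | yes refl | there m′  = there (∈-tailsWith⁺ L m′)
... | no s≢b   | here refl = ⊥-elim (s≢b refl)
... | no _     | there m′  = ∈-tailsWith⁺ L m′

tailsWith-unique : ∀ {k b} (L : List (Subset (suc k))) → Unique L → Unique (tailsWith b L)
tailsWith-unique [] _ = []
tailsWith-unique {b = b} ((s ∷ S) ∷ L) (S∉L ∷ u) with s ≟ᵇ b
... | yes refl = All.tabulate (λ m S≡ → All.lookup S∉L (∈-tailsWith⁻ L m) (cong (s ∷_) S≡)) ∷ tailsWith-unique L u
... | no _     = tailsWith-unique L u

sum-enumeration : ∀ k (L : List (Subset k)) (q : Subset k → Bool) (g : Subset k → ℤ) → Unique L →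
  (∀ S → S ∈ L ⇔ q S ≡ true) → sumℤ (map g L) ≡ ∑ˢ k (λ S → if q S then g S else 0ℤ)
sum-enumeration zero L q g u members with q [] in q₀ | L
... | true  | []           with () ← Equivalence.from (members []) q₀
... | true  | [] ∷ []     = +-identityʳ (g [])
... | true  | [] ∷ [] ∷ _ with ((≢ All.∷ _) ∷ _) ← u = ⊥-elim (≢ refl)
... | false | []           = refl
... | false | [] ∷ _       with () ← trans (sym (Equivalence.to (members []) (here refl))) q₀
sum-enumeration (suc k) L q g u members = trans (sum-tailsWith g L) (cong₂ _+_ (part true) (part false))
  where
  part : ∀ b → sumℤ (map (g ∘ (b ∷_)) (tailsWith b L)) ≡ ∑ˢ k (λ S → if q (b ∷ S) then g (b ∷ S) else 0ℤ)
  part b = sum-enumeration k (tailsWith b L) (q ∘ (b ∷_)) (g ∘ (b ∷_)) (tailsWith-unique L u) λ S →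
    mk⇔ (Equivalence.to (members _) ∘ ∈-tailsWith⁻ L) (∈-tailsWith⁺ L ∘ Equivalence.from (members _))

image : ∀ {n} → (Fin n → Fin n) → Fin n → Bool
image {n} lab y = any n (λ x → does (lab x ≟ y))

-- Merging labels along the kept edges one at a time: each edge
-- lowers the number of labels by at most one.
component-labelling : ∀ {n k} (ends : Ends n k) (keep : Fin k → Bool) →
  Σ (Fin n → Fin n) λ lab →
    (∀ j → keep j ≡ true → lab (proj₁ (ends j)) ≡ lab (proj₂ (ends j)))
    × n ≤ count n (image lab) ℕ.+ count k keep
component-labelling {n} {zero} ends keep =
  (λ x → x) , (λ ()) ,
  ≤-reflexive (sym (trans (ℕ.+-identityʳ _) (count-all n (λ y → any-intro n y (dec-true (y ≟ y) refl)))))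
component-labelling {n} {suc k} ends keep
  with lab , respects , bound ← component-labelling (ends ∘ suc) (keep ∘ suc) | keep zero in keep₀
... | false = lab , respects′ , bound
  where
  respects′ : ∀ j → keep j ≡ true → lab (proj₁ (ends j)) ≡ lab (proj₂ (ends j))
  respects′ zero    kept with () ← trans (sym kept) keep₀
  respects′ (suc j) kept = respects j kept
... | true = merge ∘ lab , respects′ , bound′
  where
  α = lab (proj₁ (ends zero))
  β = lab (proj₂ (ends zero))
  merge : Fin n → Fin n
  merge z = if does (z ≟ β) then α else z
  merge-α : merge α ≡ α
  merge-α with α ≟ β
  ... | yes _ = refl
  ... | no _  = refl
  merge-β : merge β ≡ α
  merge-β rewrite dec-true (β ≟ β) refl = refl
  respects′ : ∀ j → keep j ≡ true → merge (lab (proj₁ (ends j))) ≡ merge (lab (proj₂ (ends j)))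
  respects′ zero    _    = trans merge-α (sym merge-β)
  respects′ (suc j) kept = cong merge (respects j kept)
  survives : ∀ y → erase (image lab) β y ≡ true → image (merge ∘ lab) y ≡ true
  survives y e with y≢β , y∈img ← erase-true⁻¹ {p = image lab} e
              with x , labx≡y ← any-elim n y∈img
    = any-intro n x (subst (λ z → does (merge z ≟ y) ≡ true) (sym (does⇒ (lab x ≟ y) labx≡y)) merge-y≡y)
    where
    merge-y≡y : does (merge y ≟ y) ≡ true
    merge-y≡y rewrite dec-false (y ≟ β) y≢β = dec-true (y ≟ y) refl
  bound′ : n ≤ count n (image (merge ∘ lab)) ℕ.+ suc (count k (keep ∘ suc))
  bound′ = begin
    n                                                            ≤⟨ bound ⟩
    count n (image lab) ℕ.+ count k (keep ∘ suc)                 ≤⟨ +-monoˡ-≤ _ (count≤suc-erase n β) ⟩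
    suc (count n (erase (image lab) β)) ℕ.+ count k (keep ∘ suc) ≤⟨ +-monoˡ-≤ _ (s≤s (count-mono n survives)) ⟩
    suc (count n (image (merge ∘ lab))) ℕ.+ count k (keep ∘ suc) ≡⟨ sym (+-suc _ _) ⟩
    count n (image (merge ∘ lab)) ℕ.+ suc (count k (keep ∘ suc)) ∎
    where open ≤-Reasoning

module Walks {n e : ℕ} (ends : Ends n e) where

  end₁ end₂ : Fin e → Fin n
  end₁ = proj₁ ∘ ends
  end₂ = proj₂ ∘ ends

  Reach-trans : ∀ {S x y z} → Reach ends S x y → Reach ends S y z → Reach ends S x z
  Reach-trans here          q = q
  Reach-trans (fwd i i∈S p) q = fwd i i∈S (Reach-trans p q)
  Reach-trans (bwd i i∈S p) q = bwd i i∈S (Reach-trans p q)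

  Reach-sym : ∀ {S x y} → Reach ends S x y → Reach ends S y x
  Reach-sym here          = here
  Reach-sym (fwd i i∈S p) = Reach-trans (Reach-sym p) (bwd i i∈S here)
  Reach-sym (bwd i i∈S p) = Reach-trans (Reach-sym p) (fwd i i∈S here)

  Reach-respects : ∀ {S} (lab : Fin n → Fin n) → (∀ j → j ∈ₛ S → lab (end₁ j) ≡ lab (end₂ j)) →
                   ∀ {x y} → Reach ends S x y → lab x ≡ lab y
  Reach-respects lab resp here          = refl
  Reach-respects lab resp (fwd i i∈S p) = trans (resp i i∈S) (Reach-respects lab resp p)
  Reach-respects lab resp (bwd i i∈S p) = trans (sym (resp i i∈S)) (Reach-respects lab resp p)

  incident-end₁ : ∀ i → incident ends i (end₁ i) ≡ true
  incident-end₁ i rewrite dec-true (end₁ i ≟ end₁ i) refl = refl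

  incident-end₂ : ∀ i → incident ends i (end₂ i) ≡ true
  incident-end₂ i rewrite dec-true (end₂ i ≟ end₂ i) refl = ∨-zeroʳ _

  incident⇒end : ∀ {i x} → incident ends i x ≡ true → end₁ i ≡ x ⊎ end₂ i ≡ x
  incident⇒end {i} {x} h with end₁ i ≟ x | end₂ i ≟ x
  ... | yes p | _     = inj₁ p
  ... | no _  | yes p = inj₂ p

  Reach-via : ∀ {S i x y} → i ∈ₛ S → incident ends i x ≡ true → incident ends i y ≡ true → Reach ends S x y
  Reach-via {S} {i} i∈S ix iy = Reach-trans (to-end₁ ix) (Reach-sym (to-end₁ iy))
    where
    to-end₁ : ∀ {z} → incident ends i z ≡ true → Reach ends S z (end₁ i)
    to-end₁ iz with incident⇒end iz
    ... | inj₁ refl = here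
    ... | inj₂ refl = bwd i i∈S here

  others : Fin e → Fin e → Bool
  others i j = not (does (j ≟ i))

  without : Fin e → Subset e
  without i = tabulate (others i)

  ∈-without : ∀ {i j} → j ≢ i → j ∈ₛ without i
  ∈-without {i} {j} j≢i = lookup⇒[]= j _ (trans (lookup∘tabulate (others i) j) (cong not (dec-false (j ≟ i) j≢i)))

  ∈-without⁻¹ : ∀ {i j} → j ∈ₛ without i → others i j ≡ true
  ∈-without⁻¹ {i} {j} j∈ = trans (sym (lookup∘tabulate (others i) j)) ([]=⇒lookup j∈)

  -- An edge path avoiding i would keep a labelling constant on all of T,
  -- leaving at most 1 + (e - 1) < n labels for n vertices.
  bridge : IsTree ends → ∀ i → ¬ Reach ends (without i) (end₁ i) (end₂ i)
  bridge tree i p = 1+n≰n (begin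
    suc e                                      ≡⟨ sym (proj₁ tree) ⟩
    n                                          ≤⟨ bound ⟩
    count n (image lab) ℕ.+ count e (others i) ≤⟨ +-monoˡ-≤ _ one-label ⟩
    suc (count e (others i))                   ≡⟨ sym edges ⟩
    e                                          ∎)
    where
    open ≤-Reasoning
    lab = proj₁ (component-labelling ends (others i))
    resp = proj₁ (proj₂ (component-labelling ends (others i)))
    bound = proj₂ (proj₂ (component-labelling ends (others i)))
    c = lab (end₁ i)
    resp-without : ∀ j → j ∈ₛ without i → lab (end₁ j) ≡ lab (end₂ j)
    resp-without j j∈ = resp j (∈-without⁻¹ j∈)
    resp-all : ∀ j → j ∈ₛ ⊤ → lab (end₁ j) ≡ lab (end₂ j)
    resp-all j _ with j ≟ i
    ... | yes refl = Reach-respects lab resp-without p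
    ... | no j≢i   = resp-without j (∈-without j≢i)
    single : ∀ y → image lab y ≡ true → does (y ≟ c) ≡ true
    single y y∈ with x , labx≡y ← any-elim n y∈ =
      dec-true (y ≟ c) (trans (sym (does⇒ (lab x ≟ y) labx≡y)) (Reach-respects lab resp-all (proj₂ tree x (end₁ i))))
    one-label : count n (image lab) ≤ 1
    one-label = ≤-trans (count-mono n single)
                  (≤-reflexive (count≡1-intro n (dec-true (c ≟ c) refl) (λ y h → does⇒ (y ≟ c) h)))
    edges : e ≡ suc (count e (others i))
    edges = trans (sym (count-all e (λ _ → refl))) (count-erase e {λ _ → true} i refl)

  no-parallel : IsTree ends → ∀ {f g} → g ≢ f →
                incident ends g (end₁ f) ≡ true → incident ends g (end₂ f) ≡ true → ⊥
  no-parallel tree {f} g≢f g₁ g₂ = bridge tree f (Reach-via (∈-without g≢f) g₁ g₂)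

  edgesAt : Subset e → Fin n → Fin e → Bool
  edgesAt S x i = lookup S i ∧ incident ends i x

  degIn≡count : ∀ S x → degIn ends S x ≡ count e (edgesAt S x)
  degIn≡count S x = length-filter-tabulate e (λ i → i) (edgesAt S x)

  numInterior≡count : ∀ S → numInterior ends S ≡ count e (isInterior ends S)
  numInterior≡count S = length-filter-tabulate e (λ i → i) (isInterior ends S)

  edgesAt-true : ∀ {S i x} → i ∈ₛ S → incident ends i x ≡ true → edgesAt S x i ≡ true
  edgesAt-true i∈S ix rewrite []=⇒lookup i∈S = ix

  2≤degIn : ∀ {S i j x} → i ∈ₛ S → j ∈ₛ S → j ≢ i → incident ends i x ≡ true → incident ends j x ≡ true →
            2 ≤ degIn ends S x
  2≤degIn {S} {x = x} i∈S j∈S j≢i ix jx rewrite degIn≡count S x =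
    count≥2 e (edgesAt-true i∈S ix) (edgesAt-true j∈S jx) j≢i

  2≤degIn⇒other : ∀ {S i x} → 2 ≤ degIn ends S x → i ∈ₛ S → incident ends i x ≡ true →
                  ∃ λ j → j ≢ i × j ∈ₛ S × incident ends j x ≡ true
  2≤degIn⇒other {S} {i} {x} 2≤d i∈S ix
    with j , j≢i , atⱼ ← count≥2⇒other e (subst (2 ≤_) (degIn≡count S x) 2≤d) (edgesAt-true i∈S ix)
    = j , j≢i , lookup⇒[]= j S (∧-conicalˡ _ _ atⱼ) , ∧-conicalʳ _ _ atⱼ

  interior⁺ : ∀ {S i} → i ∈ₛ S → 2 ≤ degIn ends S (end₁ i) → 2 ≤ degIn ends S (end₂ i) →
              isInterior ends S i ≡ true
  interior⁺ i∈S d₁ d₂ rewrite []=⇒lookup i∈S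
    | Equivalence.to T-≡ (≤⇒≤ᵇ d₁) | Equivalence.to T-≡ (≤⇒≤ᵇ d₂) = refl

  interior⁻ : ∀ S i → isInterior ends S i ≡ true →
              i ∈ₛ S × 2 ≤ degIn ends S (end₁ i) × 2 ≤ degIn ends S (end₂ i)
  interior⁻ S i h =
    lookup⇒[]= i S (∧-conicalˡ _ _ h) , ≤ᵇ-true (∧-conicalˡ _ _ degs) , ≤ᵇ-true (∧-conicalʳ _ _ degs)
    where
    degs = ∧-conicalʳ (lookup S i) _ h
    ≤ᵇ-true : ∀ {m} → (2 ≤ᵇ m) ≡ true → 2 ≤ m
    ≤ᵇ-true {m} t = ≤ᵇ⇒≤ 2 m (Equivalence.from T-≡ t)

  Touches : Fin e → Fin e → Set
  Touches f g = incident ends g (end₁ f) ≡ true ⊎ incident ends g (end₂ f) ≡ true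

  record DoubleStar (S : Subset e) (f : Fin e) : Set where
    field
      interior : isInterior ends S f ≡ true
      touches  : ∀ {g} → g ∈ₛ S → Touches f g

  Reach-centre : ∀ {R f h w} → f ∈ₛ R → h ∈ₛ R → Touches f h → incident ends h w ≡ true →
                 Reach ends R w (end₁ f)
  Reach-centre f∈R h∈R (inj₁ h₁) hw = Reach-via h∈R hw h₁
  Reach-centre {f = f} f∈R h∈R (inj₂ h₂) hw = Reach-trans (Reach-via h∈R hw h₂) (bwd f f∈R here)

  doubleStar⇒subtree : ∀ {S f} → DoubleStar S f → IsSubtree ends S
  doubleStar⇒subtree {S} {f} ds = (f , f∈S) , λ i j i∈S j∈S →
    Reach-trans (to-centre i∈S) (Reach-sym (to-centre j∈S))
    where
    open DoubleStar ds
    f∈S = proj₁ (interior⁻ S f interior)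
    to-centre : ∀ {i} → i ∈ₛ S → Reach ends S (end₁ i) (end₁ f)
    to-centre {i} i∈S = Reach-centre f∈S i∈S (touches i∈S) (incident-end₁ i)

  doubleStar-unique : IsTree ends → ∀ {S f g} → DoubleStar S f → isInterior ends S g ≡ true → g ≡ f
  doubleStar-unique tree {S} {f} {g} ds g-int with g ≟ f
  ... | yes g≡f = g≡f
  ... | no g≢f  =
    ⊥-elim (bridge tree g (Reach-trans (around d₁ (incident-end₁ g)) (Reach-sym (around d₂ (incident-end₂ g)))))
    where
    open DoubleStar ds
    f∈S = proj₁ (interior⁻ S f interior)
    g∈S = proj₁ (interior⁻ S g g-int)
    d₁ = proj₁ (proj₂ (interior⁻ S g g-int))
    d₂ = proj₂ (proj₂ (interior⁻ S g g-int))
    around : ∀ {w} → 2 ≤ degIn ends S w → incident ends g w ≡ true → Reach ends (without g) w (end₁ f)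
    around dw gw with h , h≢g , h∈S , hw ← 2≤degIn⇒other dw g∈S gw =
      Reach-centre (∈-without (λ f≡g → g≢f (sym f≡g))) (∈-without h≢g) (touches h∈S) hw

  doubleStar⇒one-interior : IsTree ends → ∀ {S f} → DoubleStar S f → numInterior ends S ≡ 1
  doubleStar⇒one-interior tree {S} ds = trans (numInterior≡count S)
    (count≡1-intro e (DoubleStar.interior ds) (λ g g-int → doubleStar-unique tree ds g-int))

  Joins : Fin e → Fin n → Fin n → Set
  Joins i x x′ = (end₁ i ≡ x × end₂ i ≡ x′) ⊎ (end₁ i ≡ x′ × end₂ i ≡ x)

  Joins-incident : ∀ {i x x′} → Joins i x x′ → incident ends i x ≡ true × incident ends i x′ ≡ true
  Joins-incident {i} (inj₁ (refl , refl)) = incident-end₁ i , incident-end₂ i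
  Joins-incident {i} (inj₂ (refl , refl)) = incident-end₂ i , incident-end₁ i

  Joins-ends : ∀ {i x x′ z} → Joins i x x′ → incident ends i z ≡ true → z ≡ x ⊎ z ≡ x′
  Joins-ends (inj₁ (p , q)) iz with incident⇒end iz
  ... | inj₁ r = inj₁ (trans (sym r) p)
  ... | inj₂ r = inj₂ (trans (sym r) q)
  Joins-ends (inj₂ (p , q)) iz with incident⇒end iz
  ... | inj₁ r = inj₂ (trans (sym r) p)
  ... | inj₂ r = inj₁ (trans (sym r) q)

  Joins-interior : ∀ {S i x x′} → Joins i x x′ → i ∈ₛ S → 2 ≤ degIn ends S x → 2 ≤ degIn ends S x′ →
                   isInterior ends S i ≡ true
  Joins-interior (inj₁ (refl , refl)) i∈S d d′ = interior⁺ i∈S d d′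
  Joins-interior (inj₂ (refl , refl)) i∈S d d′ = interior⁺ i∈S d′ d

  -- Along any path in S starting at an end of f, every vertex is an end of f
  -- or a leaf hanging from an edge that touches f.
  module _ {S f} (subtree : IsSubtree ends S) (f-int : isInterior ends S f ≡ true)
           (unique : ∀ g → isInterior ends S g ≡ true → g ≡ f) where

    private
      f∈S = proj₁ (interior⁻ S f f-int)
      d₁  = proj₁ (proj₂ (interior⁻ S f f-int))
      d₂  = proj₂ (proj₂ (interior⁻ S f f-int))

    Leaf : Fin n → Set
    Leaf x = ∃ λ h → h ∈ₛ S × Touches f h × incident ends h x ≡ true ×
                     (∀ {h′} → h′ ∈ₛ S → incident ends h′ x ≡ true → h′ ≡ h)

    Near : Fin n → Set
    Near x = x ≡ end₁ f ⊎ x ≡ end₂ f ⊎ Leaf x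

    beyond-branching : ∀ {i x x′} → i ∈ₛ S → Joins i x x′ → 2 ≤ degIn ends S x → Touches f i → Near x′
    beyond-branching {i} {x} {x′} i∈S joins dx touch with x′ ≟ end₁ f | x′ ≟ end₂ f
    ... | yes x′≡₁ | _         = inj₁ x′≡₁
    ... | no _     | yes x′≡₂  = inj₂ (inj₁ x′≡₂)
    ... | no x′≢₁  | no x′≢₂   = inj₂ (inj₂ (i , i∈S , touch , proj₂ (Joins-incident joins) , only-i))
      where
      not-f : i ≢ f
      not-f refl with incident⇒end (proj₂ (Joins-incident joins))
      ... | inj₁ e = x′≢₁ (sym e)
      ... | inj₂ e = x′≢₂ (sym e)
      only-i : ∀ {h′} → h′ ∈ₛ S → incident ends h′ x′ ≡ true → h′ ≡ i
      only-i {h′} h′∈S h′x′ with h′ ≟ i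
      ... | yes h′≡i = h′≡i
      ... | no h′≢i  = ⊥-elim (not-f (unique i (Joins-interior joins i∈S dx
                         (2≤degIn i∈S h′∈S h′≢i (proj₂ (Joins-incident joins)) h′x′))))

    beyond-touching : ∀ {i x x′} → i ∈ₛ S → Joins i x x′ → Touches f i → Near x′
    beyond-touching i∈S joins (inj₁ i₁) with Joins-ends joins i₁
    ... | inj₁ refl = beyond-branching i∈S joins d₁ (inj₁ i₁)
    ... | inj₂ refl = inj₁ refl
    beyond-touching i∈S joins (inj₂ i₂) with Joins-ends joins i₂
    ... | inj₁ refl = beyond-branching i∈S joins d₂ (inj₂ i₂)
    ... | inj₂ refl = inj₂ (inj₁ refl)

    Near-step : ∀ {i x x′} → i ∈ₛ S → Joins i x x′ → Near x → Near x′
    Near-step i∈S joins (inj₁ refl)        = beyond-branching i∈S joins d₁ (inj₁ (proj₁ (Joins-incident joins)))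
    Near-step i∈S joins (inj₂ (inj₁ refl)) = beyond-branching i∈S joins d₂ (inj₂ (proj₁ (Joins-incident joins)))
    Near-step i∈S joins (inj₂ (inj₂ (h , _ , touch , _ , only-h)))
      with refl ← only-h i∈S (proj₁ (Joins-incident joins)) = beyond-touching i∈S joins touch

    Near-closed : ∀ {x y} → Near x → Reach ends S x y → Near y
    Near-closed near here          = near
    Near-closed near (fwd i i∈S p) = Near-closed (Near-step i∈S (inj₁ (refl , refl)) near) p
    Near-closed near (bwd i i∈S p) = Near-closed (Near-step i∈S (inj₂ (refl , refl)) near) p

    one-interior⇒doubleStar : DoubleStar S f
    one-interior⇒doubleStar = record { interior = f-int ; touches = touches }
      where
      touches : ∀ {g} → g ∈ₛ S → Touches f g
      touches {g} g∈S with Near-closed (inj₁ refl) (proj₂ subtree f g f∈S g∈S)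
      ... | inj₁ e = inj₁ (subst (λ z → incident ends g z ≡ true) e (incident-end₁ g))
      ... | inj₂ (inj₁ e) = inj₂ (subst (λ z → incident ends g z ≡ true) e (incident-end₁ g))
      ... | inj₂ (inj₂ (h , _ , touch , _ , only-h)) with refl ← only-h g∈S (incident-end₁ g) = touch

  one-interior⇒∃doubleStar : ∀ {S} → IsSubtree ends S → numInterior ends S ≡ 1 → ∃ λ f → DoubleStar S f
  one-interior⇒∃doubleStar {S} subtree one
    with f , f-int , unique ← count≡1-elim e (trans (sym (numInterior≡count S)) one) =
    f , one-interior⇒doubleStar subtree f-int unique

  -- Classifying edges by their role relative to f turns being a double star
  -- around f into a pattern that shape checks edge by edge.
  role : Fin e → Fin e → Role
  role f g = if does (g ≟ f) then centre
             else if incident ends g (end₁ f) then arm₁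
             else if incident ends g (end₂ f) then arm₂
             else other

  data RoleSpec (f g : Fin e) : Role → Set where
    centre : g ≡ f → RoleSpec f g centre
    arm₁   : g ≢ f → incident ends g (end₁ f) ≡ true → RoleSpec f g arm₁
    arm₂   : g ≢ f → incident ends g (end₁ f) ≡ false → incident ends g (end₂ f) ≡ true → RoleSpec f g arm₂
    other  : g ≢ f → incident ends g (end₁ f) ≡ false → incident ends g (end₂ f) ≡ false → RoleSpec f g other

  role-spec : ∀ f g → RoleSpec f g (role f g)
  role-spec f g with g ≟ f | incident ends g (end₁ f) in g₁ | incident ends g (end₂ f) in g₂
  ... | yes g≡f | _     | _     = centre g≡f
  ... | no g≢f  | true  | _     = arm₁ g≢f g₁
  ... | no g≢f  | false | true  = arm₂ g≢f g₁ g₂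
  ... | no g≢f  | false | false = other g≢f g₁ g₂

  role≡ : ∀ f g {ρ} → role f g ≡ ρ → RoleSpec f g ρ
  role≡ f g refl = role-spec f g

  role-centre : ∀ f → role f f ≡ centre
  role-centre f rewrite dec-true (f ≟ f) refl = refl

  role-arm₁ : ∀ {f g} → g ≢ f → incident ends g (end₁ f) ≡ true → role f g ≡ arm₁
  role-arm₁ {f} {g} g≢f g₁ rewrite dec-false (g ≟ f) g≢f | g₁ = refl

  role-arm₂ : ∀ {f g} → g ≢ f → incident ends g (end₁ f) ≡ false → incident ends g (end₂ f) ≡ true →
              role f g ≡ arm₂
  role-arm₂ {f} {g} g≢f g₁ g₂ rewrite dec-false (g ≟ f) g≢f | g₁ | g₂ = refl

  Met-arm₁⇒degIn : ∀ {S f} → f ∈ₛ S → Met false (isArm₁ ∘ role f) S → 2 ≤ degIn ends S (end₁ f)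
  Met-arm₁⇒degIn {S} {f} f∈S (inj₂ (g , a , Sg)) with arm₁ g≢f g₁ ← role≡ f g (isArm₁-true a) =
    2≤degIn f∈S (lookup⇒[]= g S Sg) g≢f (incident-end₁ f) g₁

  Met-arm₂⇒degIn : ∀ {S f} → f ∈ₛ S → Met false (isArm₂ ∘ role f) S → 2 ≤ degIn ends S (end₂ f)
  Met-arm₂⇒degIn {S} {f} f∈S (inj₂ (g , a , Sg)) with arm₂ g≢f _ g₂ ← role≡ f g (isArm₂-true a) =
    2≤degIn f∈S (lookup⇒[]= g S Sg) g≢f (incident-end₂ f) g₂

  degIn⇒Met-arm₁ : ∀ {S f} → f ∈ₛ S → 2 ≤ degIn ends S (end₁ f) → Met false (isArm₁ ∘ role f) S
  degIn⇒Met-arm₁ {f = f} f∈S d with g , g≢f , g∈S , g₁ ← 2≤degIn⇒other d f∈S (incident-end₁ f) =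
    inj₂ (g , cong isArm₁ (role-arm₁ g≢f g₁) , []=⇒lookup g∈S)

  degIn⇒Met-arm₂ : IsTree ends → ∀ {S f} → f ∈ₛ S → 2 ≤ degIn ends S (end₂ f) →
                   Met false (isArm₂ ∘ role f) S
  degIn⇒Met-arm₂ tree {f = f} f∈S d with g , g≢f , g∈S , g₂ ← 2≤degIn⇒other d f∈S (incident-end₂ f) =
    inj₂ (g , cong isArm₂ (role-arm₂ g≢f (¬-not (λ g₁ → no-parallel tree g≢f g₁ g₂)) g₂) , []=⇒lookup g∈S)

  Fits-role⇒doubleStar : ∀ {S f} → Fits (role f) false false S → DoubleStar S f
  Fits-role⇒doubleStar {S} {f} fits =
    record { interior = interior⁺ f∈S (Met-arm₁⇒degIn f∈S met₁) (Met-arm₂⇒degIn f∈S met₂) ; touches = touches }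
    where
    open Fits fits
    f∈S = lookup⇒[]= f S (centreIn f (role-centre f))
    touches : ∀ {g} → g ∈ₛ S → Touches f g
    touches {g} g∈S with role f g in r | role-spec f g
    ... | centre | centre refl = inj₁ (incident-end₁ f)
    ... | arm₁   | arm₁ _ g₁   = inj₁ g₁
    ... | arm₂   | arm₂ _ _ g₂ = inj₂ g₂
    ... | other  | other _ _ _ with () ← trans (sym ([]=⇒lookup g∈S)) (otherOut g r)

  doubleStar⇒Fits-role : IsTree ends → ∀ {S f} → DoubleStar S f → Fits (role f) false false S
  doubleStar⇒Fits-role tree {S} {f} ds = record
    { centreIn = centre∈S
    ; otherOut = other∉S
    ; met₁ = degIn⇒Met-arm₁ f∈S (proj₁ (proj₂ (interior⁻ S f interior)))
    ; met₂ = degIn⇒Met-arm₂ tree f∈S (proj₂ (proj₂ (interior⁻ S f interior))) }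
    where
    open DoubleStar ds
    f∈S = proj₁ (interior⁻ S f interior)
    centre∈S : ∀ i → role f i ≡ centre → lookup S i ≡ true
    centre∈S i r with centre refl ← role≡ f i r = []=⇒lookup f∈S
    other∉S : ∀ i → role f i ≡ other → lookup S i ≡ false
    other∉S i r with other _ i₁ i₂ ← role≡ f i r = ¬-not λ Sᵢ → case touches (lookup⇒[]= i S Sᵢ) of λ where
      (inj₁ t) → case trans (sym t) i₁ of λ ()
      (inj₂ t) → case trans (sym t) i₂ of λ ()

  isInterior-⊤ : IsTree ends → ∀ f → isInterior ends ⊤ f ≡ any e (isArm₁ ∘ role f) ∧ any e (isArm₂ ∘ role f)
  isInterior-⊤ tree f with any e (isArm₁ ∘ role f) in a₁ | any e (isArm₂ ∘ role f) in a₂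
  ... | true  | true  = interior⁺ ∈⊤ (Met-arm₁⇒degIn ∈⊤ (any⇒Met-⊤ a₁)) (Met-arm₂⇒degIn ∈⊤ (any⇒Met-⊤ a₂))
  ... | false | _     = ¬-not λ int →
    case trans (sym (Met-false⇒any {S = ⊤} (degIn⇒Met-arm₁ ∈⊤ (proj₁ (proj₂ (interior⁻ ⊤ f int)))))) a₁ of λ ()
  ... | true  | false = ¬-not λ int →
    case trans (sym (Met-false⇒any {S = ⊤} (degIn⇒Met-arm₂ tree ∈⊤ (proj₂ (proj₂ (interior⁻ ⊤ f int)))))) a₂ of λ ()

  count-centre≡1 : ∀ f → count e (isCentre ∘ role f) ≡ 1
  count-centre≡1 f = count≡1-intro e (cong isCentre (role-centre f)) only-f
    where
    only-f : ∀ g → isCentre (role f g) ≡ true → g ≡ f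
    only-f g c with centre g≡f ← role≡ f g (isCentre-true c) = g≡f

  signedShape-role : IsTree ends → ∀ f →
                     signedShape e (role f) false false ≡ (if isInterior ends ⊤ f then -1ℤ else 0ℤ)
  signedShape-role tree f rewrite signedShape-closed e (role f) false false | count-centre≡1 f | isInterior-⊤ tree f
    with any e (isArm₁ ∘ role f) | any e (isArm₂ ∘ role f)
  ... | true  | true  = refl
  ... | true  | false = refl
  ... | false | true  = refl
  ... | false | false = refl

  isDoubleStar : Subset e → Fin e → Bool
  isDoubleStar S f = shape e (role f) false false S

  isDoubleStar⇒DoubleStar : ∀ {S f} → isDoubleStar S f ≡ true → DoubleStar S f
  isDoubleStar⇒DoubleStar {S} {f} h = Fits-role⇒doubleStar (shape⇒Fits e (role f) false false S h)

  isDoubleStar-unique : IsTree ends → ∀ {S f g} → isDoubleStar S f ≡ true → isDoubleStar S g ≡ true → f ≡ g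
  isDoubleStar-unique tree f-star g-star =
    doubleStar-unique tree (isDoubleStar⇒DoubleStar g-star) (DoubleStar.interior (isDoubleStar⇒DoubleStar f-star))

  one-interior⇔doubleStar : IsTree ends → ∀ S →
                            (IsSubtree ends S × numInterior ends S ≡ 1) ⇔ any e (isDoubleStar S) ≡ true
  one-interior⇔doubleStar tree S = mk⇔
    (λ (subtree , one) → let f , ds = one-interior⇒∃doubleStar subtree one in
      any-intro e f (Fits⇒shape e (role f) false false S (doubleStar⇒Fits-role tree ds)))
    (λ h → let f , f-star = any-elim e h ; ds = isDoubleStar⇒DoubleStar f-star in
      doubleStar⇒subtree ds , doubleStar⇒one-interior tree ds)

theorem4p7 : (n e : ℕ) (ends : Ends n e) → IsTree ends →
    (L : List (Subset e)) → Unique L →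
    (∀ S → (S ∈ L) ⇔ (IsSubtree ends S × numInterior ends S ≡ 1)) →
    sumℤ (map (λ S → -1ℤ ^ ∣ S ∣) L) ≡ - (+ numInterior ends ⊤)
theorem4p7 n e ends tree L unique members = begin
  sumℤ (map sgn L)
    ≡⟨ sum-enumeration e L (any e ∘ isDoubleStar) sgn unique
         (λ S → ⇔.trans (members S) (one-interior⇔doubleStar tree S)) ⟩
  ∑ˢ e (λ S → if any e (isDoubleStar S) then sgn S else 0ℤ)
    ≡⟨ ∑ˢ-cong e (λ S → sym (∑-indicator-unique e (isDoubleStar S) (sgn S) (isDoubleStar-unique tree))) ⟩
  ∑ˢ e (λ S → ∑[ f < e ] (if isDoubleStar S f then sgn S else 0ℤ))
    ≡⟨ ∑ˢ-∑-comm e e _ ⟩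
  ∑[ f < e ] signedShape e (role f) false false
    ≡⟨ sum-cong-≗ (signedShape-role tree) ⟩
  ∑[ f < e ] (if isInterior ends ⊤ f then -1ℤ else 0ℤ)
    ≡⟨ ∑-indicator-count e (isInterior ends ⊤) ⟩
  - (+ count e (isInterior ends ⊤))
    ≡⟨ cong (-_ ∘ +_) (sym (numInterior≡count ⊤)) ⟩
  - (+ numInterior ends ⊤) ∎
  where
  open ≡-Reasoning
  open Walks ends
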